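{- Let $\lambda=(\lambda_1,\ldots,\lambda_t)$ be an unrefinable partition into distinct parts with $\#\mathcal{M}_\lambda=\lfloor\lambda_t/2\rfloor$, such that $\lambda_t$ is odd and $\lambda_t\neq 3\mu$ for every $\mu\in\mathcal{M}_\lambda$. Then the set $S_\lambda=\mathbb{N}_0\setminus\{\lambda_1,\ldots,\lambda_t\}$ is a numerical semigroup.
   Context: A partition into distinct parts is a sequence $\lambda=(\lambda_1,\ldots,\lambda_t)$ of positive integers with $\lambda_1<\cdots<\lambda_t$ and $t\ge 2$. Its set of missing parts is $\mathcal{M}_\lambda=\{1,\ldots,\lambda_t\}\setminus\{\lambda_1,\ldots,\lambda_t\}$. $\lambda$ is refinable if some part equals a sum of at least two pairwise distinct missing parts, and unrefinable otherwise. A numerical semigroup is a subset of $\mathbb{N}_0$ containing $0$, closed under addition, with finite complement in $\mathbb{N}_0$. -}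

module Defs where

open import Data.Nat using (ℕ; zero; suc; _+_; _*_; _≤_; _<_; _≥_; _⊔_; _/_)
open import Data.Nat.ListAction using (sum)
open import Data.List using (List; []; _∷_; length; foldr; filter; upTo; map)
open import Data.List.Membership.Propositional using (_∈_; _∉_)
open import Data.List.Relation.Unary.Linked using (Linked)
open import Data.List.Relation.Unary.All using (All)
open import Data.List.Relation.Unary.Unique.Propositional using (Unique)
open import Data.List.Membership.DecPropositional (Data.Nat._≟_) using (_∉?_)
open import Data.Product using (Σ; _×_; ∃; ∃-syntax)
open import Relation.Nullary using (¬_)
open import Relation.Binary.PropositionalEquality using (_≡_)

record DistinctPartition (l : List ℕ) : Set where
  field
    positive   : All (λ x → 1 ≤ x) l
    increasing : Linked _<_ l
    atLeastTwo : 2 ≤ length l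

-- largest part λ_t (the maximum of the parts; for a strictly increasing
-- list this is the last element)
largest : List ℕ → ℕ
largest = foldr _⊔_ 0

IsMissing : List ℕ → ℕ → Set
IsMissing l m = 1 ≤ m × m ≤ largest l × m ∉ l

-- M_λ as an explicit list (sorted, duplicate-free), used for its cardinality
missingList : List ℕ → List ℕ
missingList l = filter (_∉? l) (map suc (upTo (largest l)))

numMissing : List ℕ → ℕ
numMissing l = length (missingList l)

Refinable : List ℕ → Set
Refinable l = ∃[ p ] ∃[ ms ] (p ∈ l × 2 ≤ length ms × Unique ms
                 × All (IsMissing l) ms × sum ms ≡ p)

Unrefinable : List ℕ → Set
Unrefinable l = ¬ Refinable l

record NumericalSemigroup (S : ℕ → Set) : Set where
  field
    has-zero  : S 0
    closed    : ∀ a b → S a → S b → S (a + b)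
    cofinite  : ∃[ N ] (∀ n → N ≤ n → S n)

Sλ : List ℕ → ℕ → Set
Sλ l n = n ∉ l

-- Write L = 2k + 1 for the largest part. Unrefinability forbids both members of a pair
-- {i, L - i} (1 ≤ i ≤ k) from being missing, and since there are exactly k missing parts,
-- exactly one member of every such pair is missing; in particular x + y = L never has two
-- parts as summands. Now let a, b be non-parts with a + b a part. If a ≠ b, the part a + b
-- refines. If a = b, write L = 2a + y: y is missing because 2a is a part, and then either
-- the part a + y refines (a ≠ y as L ≠ 3a), or a + y is missing and L = a + (a + y) refines.
module Submission where

open import Defs
open import Data.Nat using (ℕ; _*_; _/_; _%_; zero; suc; _+_; _≤_; _<_; z≤n; s≤s; _≟_)
open import Data.Nat.Properties
open import Data.Nat.DivMod using (m≡m%n+[m/n]*n)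
open import Data.List using (List; []; _∷_; length; filter; map; upTo; applyUpTo)
open import Data.List.Properties using (map-upTo)
open import Data.List.Membership.Propositional using (_∈_; _∉_)
open import Data.List.Membership.DecPropositional (Data.Nat._≟_) using (_∉?_; _∈?_)
open import Data.List.Relation.Unary.Any using (here; there)
open import Data.List.Relation.Unary.All as All using ([]; _∷_)
open import Data.List.Relation.Unary.AllPairs using ([]; _∷_)
open import Data.Product using (_,_)
open import Data.Sum using (inj₁; inj₂)
open import Data.Empty using (⊥; ⊥-elim)
open import Function using (_∘_)
open import Relation.Nullary using (Dec; yes; no)
open import Relation.Unary using (Pred; Decidable)
open import Relation.Binary.PropositionalEquality
  using (_≡_; _≢_; refl; sym; trans; cong; cong₂; subst; module ≡-Reasoning)

open ≡-Reasoning

indicator : ∀ {a} {A : Set a} → Dec A → ℕ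
indicator (yes _) = 1
indicator (no _)  = 0

sumBelow : (ℕ → ℕ) → ℕ → ℕ
sumBelow f zero    = 0
sumBelow f (suc n) = f 0 + sumBelow (f ∘ suc) n

sumBelow-suc : ∀ f n → sumBelow f (suc n) ≡ sumBelow f n + f n
sumBelow-suc f zero    = +-identityʳ (f 0)
sumBelow-suc f (suc n) = begin
  f 0 + sumBelow (f ∘ suc) (suc n)         ≡⟨ cong (f 0 +_) (sumBelow-suc (f ∘ suc) n) ⟩
  f 0 + (sumBelow (f ∘ suc) n + f (suc n)) ≡⟨ +-assoc (f 0) _ _ ⟨
  sumBelow f (suc n) + f (suc n)           ∎

length-filter-applyUpTo : ∀ {p} {P : Pred ℕ p} (P? : Decidable P) g n →
  length (filter P? (applyUpTo g n)) ≡ sumBelow (λ i → indicator (P? (g i))) n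
length-filter-applyUpTo P? g zero = refl
length-filter-applyUpTo P? g (suc n) with P? (g 0)
... | yes _ = cong suc (length-filter-applyUpTo P? (g ∘ suc) n)
... | no _  = length-filter-applyUpTo P? (g ∘ suc) n

-- The indices 0 … 2n - 1 fall into the n mirror pairs {i, j} with i + j = 2n - 1.
MirrorSums≤1 : ℕ → (ℕ → ℕ) → Set
MirrorSums≤1 n f = ∀ i j → suc (i + j) ≡ n + n → f i + f j ≤ 1

mirror-suc : ∀ m i j → suc (i + j) ≡ m + m → suc (suc i + suc j) ≡ suc m + suc m
mirror-suc m i j e = cong suc (begin
  suc (i + suc j)   ≡⟨ cong suc (+-suc i j) ⟩
  suc (suc (i + j)) ≡⟨ cong suc e ⟩
  suc (m + m)       ≡⟨ +-suc m m ⟨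
  m + suc m         ∎)

mirror-ends : ∀ m → suc (0 + suc (m + m)) ≡ suc m + suc m
mirror-ends m = cong suc (sym (+-suc m m))

MirrorSums≤1-inner : ∀ m f → MirrorSums≤1 (suc m) f → MirrorSums≤1 m (f ∘ suc)
MirrorSums≤1-inner m f h i j e = h (suc i) (suc j) (mirror-suc m i j e)

sumBelow-mirror : ∀ f m →
  sumBelow f (suc m + suc m) ≡ (f 0 + f (suc (m + m))) + sumBelow (f ∘ suc) (m + m)
sumBelow-mirror f m = begin
  f 0 + sumBelow (f ∘ suc) (m + suc m)                 ≡⟨ cong (λ t → f 0 + sumBelow (f ∘ suc) t) (+-suc m m) ⟩
  f 0 + sumBelow (f ∘ suc) (suc (m + m))               ≡⟨ cong (f 0 +_) (sumBelow-suc (f ∘ suc) (m + m)) ⟩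
  f 0 + (sumBelow (f ∘ suc) (m + m) + f (suc (m + m))) ≡⟨ cong (f 0 +_) (+-comm _ (f (suc (m + m)))) ⟩
  f 0 + (f (suc (m + m)) + sumBelow (f ∘ suc) (m + m)) ≡⟨ +-assoc (f 0) _ _ ⟨
  (f 0 + f (suc (m + m))) + sumBelow (f ∘ suc) (m + m) ∎

sumBelow-mirror-≤ : ∀ n f → MirrorSums≤1 n f → sumBelow f (n + n) ≤ n
sumBelow-mirror-≤ zero    f h = z≤n
sumBelow-mirror-≤ (suc m) f h rewrite sumBelow-mirror f m =
  +-mono-≤ (h 0 (suc (m + m)) (mirror-ends m)) (sumBelow-mirror-≤ m (f ∘ suc) (MirrorSums≤1-inner m f h))

sumBelow-mirror-<-ends : ∀ m f → MirrorSums≤1 (suc m) f →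
  f 0 + f (suc (m + m)) ≡ 0 → sumBelow f (suc m + suc m) < suc m
sumBelow-mirror-<-ends m f h z rewrite sumBelow-mirror f m | z =
  s≤s (sumBelow-mirror-≤ m (f ∘ suc) (MirrorSums≤1-inner m f h))

sumBelow-mirror-< : ∀ n f → MirrorSums≤1 n f →
  ∀ i j → suc (i + j) ≡ n + n → f i + f j ≡ 0 → sumBelow f (n + n) < n
sumBelow-mirror-< (suc m) f h zero j e z =
  sumBelow-mirror-<-ends m f h (subst (λ t → f 0 + f t ≡ 0) j≡ z)
  where
  j≡ : j ≡ suc (m + m)
  j≡ = trans (suc-injective e) (+-suc m m)
sumBelow-mirror-< (suc m) f h (suc i) zero e z =
  sumBelow-mirror-<-ends m f h (subst (λ t → f 0 + f t ≡ 0) i≡ (trans (+-comm (f 0) _) z))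
  where
  i≡ : suc i ≡ suc (m + m)
  i≡ = trans (sym (+-identityʳ (suc i))) (trans (suc-injective e) (+-suc m m))
sumBelow-mirror-< (suc m) f h (suc i) (suc j) e z rewrite sumBelow-mirror f m =
  +-mono-≤-< (h 0 (suc (m + m)) (mirror-ends m))
    (sumBelow-mirror-< m (f ∘ suc) (MirrorSums≤1-inner m f h) i j inner z)
  where
  inner : suc (i + j) ≡ m + m
  inner = suc-injective (begin
    suc (suc (i + j)) ≡⟨ cong suc (+-suc i j) ⟨
    suc (i + suc j)   ≡⟨ suc-injective e ⟩
    m + suc m         ≡⟨ +-suc m m ⟩
    suc (m + m)       ∎)

odd≢double : ∀ i j → suc (i + i) ≢ j + j
odd≢double i j e = even≢odd j i (begin
  j + (j + 0)       ≡⟨ cong (j +_) (+-identityʳ j) ⟩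
  j + j             ≡⟨ e ⟨
  suc (i + i)       ≡⟨ cong (λ t → suc (i + t)) (+-identityʳ i) ⟨
  suc (i + (i + 0)) ∎)

odd-as-double : ∀ n → n % 2 ≡ 1 → n ≡ suc (n / 2 + n / 2)
odd-as-double n odd = begin
  n                         ≡⟨ m≡m%n+[m/n]*n n 2 ⟩
  n % 2 + n / 2 * 2         ≡⟨ cong₂ _+_ odd (*-comm (n / 2) 2) ⟩
  1 + (n / 2 + (n / 2 + 0)) ≡⟨ cong (λ t → suc (n / 2 + t)) (+-identityʳ (n / 2)) ⟩
  suc (n / 2 + n / 2)       ∎

≤-largest : ∀ {x} l → x ∈ l → x ≤ largest l
≤-largest (y ∷ ys) (here refl)  = m≤m⊔n y (largest ys)
≤-largest (y ∷ ys) (there x∈ys) = ≤-trans (≤-largest ys x∈ys) (m≤n⊔m y (largest ys))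

largest-∈ : ∀ x xs → largest (x ∷ xs) ∈ x ∷ xs
largest-∈ x [] = here (⊔-identityʳ x)
largest-∈ x (y ∷ ys) with ⊔-sel x (largest (y ∷ ys))
... | inj₁ eq = here eq
... | inj₂ eq = there (subst (_∈ y ∷ ys) (sym eq) (largest-∈ y ys))

0∉parts : ∀ {l} → DistinctPartition l → 0 ∉ l
0∉parts dp 0∈l with All.lookup (DistinctPartition.positive dp) 0∈l
... | ()

largest∈parts : ∀ {l} → DistinctPartition l → largest l ∈ l
largest∈parts {x ∷ xs} _ = largest-∈ x xs

refinable-pair : ∀ {l x y} → x ≢ y → IsMissing l x → IsMissing l y → x + y ∈ l → Refinable l
refinable-pair {x = x} {y} x≢y mx my x+y∈l =
  x + y , x ∷ y ∷ [] , x+y∈l , s≤s (s≤s z≤n) , (x≢y ∷ []) ∷ [] ∷ [] , mx ∷ my ∷ [] ,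
  cong (x +_) (+-identityʳ y)

missing-summand : ∀ {l x y} → x + y ≤ largest l → x ∉ l → 1 ≤ x → IsMissing l x
missing-summand {x = x} {y} x+y≤L x∉l 1≤x = 1≤x , ≤-trans (m≤m+n x y) x+y≤L , x∉l

module _ {l : List ℕ} (dp : DistinctPartition l) (unref : Unrefinable l)
         {k : ℕ} (L≡ : largest l ≡ suc (k + k)) where

  complement-part : ∀ x y → x + y ≡ largest l → x + y ∈ l
  complement-part _ _ x+y≡L = subst (_∈ l) (sym x+y≡L) (largest∈parts dp)

  not-both-missing : ∀ {x y} → x + y ≡ largest l → IsMissing l x → IsMissing l y → ⊥
  not-both-missing {x} {y} x+y≡L mx my =
    unref (refinable-pair x≢y mx my (complement-part x y x+y≡L))
    where
    x≢y : x ≢ y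
    x≢y refl = odd≢double k x (trans (sym L≡) (sym x+y≡L))

  double<largest : ∀ {a} → a + a ∈ l → a + a < largest l
  double<largest {a} a+a∈l =
    ≤∧≢⇒< (≤-largest l a+a∈l) (λ 2a≡L → odd≢double k a (trans (sym L≡) (sym 2a≡L)))

  missingAt : ℕ → ℕ
  missingAt i = indicator (suc i ∉? l)

  missingAt-part : ∀ {i} → suc i ∈ l → missingAt i ≡ 0
  missingAt-part {i} i+1∈l with suc i ∉? l
  ... | yes i+1∉l = ⊥-elim (i+1∉l i+1∈l)
  ... | no _      = refl

  mirror-missingAt : MirrorSums≤1 k missingAt
  mirror-missingAt i j e with suc i ∉? l | suc j ∉? l
  ... | yes i+1∉l | yes j+1∉l =
    ⊥-elim (not-both-missing sum≡L
      (missing-summand (≤-reflexive sum≡L) i+1∉l (s≤s z≤n))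
      (missing-summand (≤-reflexive (trans (+-comm (suc j) (suc i)) sum≡L)) j+1∉l (s≤s z≤n)))
    where
    sum≡L : suc i + suc j ≡ largest l
    sum≡L = trans (cong suc (+-suc i j)) (trans (cong suc e) (sym L≡))
  ... | yes _ | no _  = ≤-refl
  ... | no _  | yes _ = ≤-refl
  ... | no _  | no _  = z≤n

  numMissing≡sumBelow : numMissing l ≡ sumBelow missingAt (k + k)
  numMissing≡sumBelow = begin
    length (filter (_∉? l) (map suc (upTo L)))     ≡⟨ cong (length ∘ filter (_∉? l)) (map-upTo suc L) ⟩
    length (filter (_∉? l) (applyUpTo suc L))      ≡⟨ length-filter-applyUpTo (_∉? l) suc L ⟩
    sumBelow missingAt L                           ≡⟨ cong (sumBelow missingAt) L≡ ⟩
    sumBelow missingAt (suc (k + k))               ≡⟨ sumBelow-suc missingAt (k + k) ⟩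
    sumBelow missingAt (k + k) + missingAt (k + k) ≡⟨ cong (sumBelow missingAt (k + k) +_) (missingAt-part L∈l) ⟩
    sumBelow missingAt (k + k) + 0                 ≡⟨ +-identityʳ _ ⟩
    sumBelow missingAt (k + k)                     ∎
    where
    L : ℕ
    L = largest l
    L∈l : suc (k + k) ∈ l
    L∈l = subst (_∈ l) L≡ (largest∈parts dp)

  module _ (count : numMissing l ≡ k) where

    not-both-parts : ∀ {x y} → x + y ≡ largest l → x ∈ l → y ∈ l → ⊥
    not-both-parts {zero}          _ 0∈l _   = 0∉parts dp 0∈l
    not-both-parts {suc _} {zero}  _ _   0∈l = 0∉parts dp 0∈l
    not-both-parts {suc i} {suc j} x+y≡L x∈l y∈l =
      <-irrefl (trans (sym numMissing≡sumBelow) count)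
        (sumBelow-mirror-< k missingAt mirror-missingAt i j
          (trans (sym (+-suc i j)) (suc-injective (trans x+y≡L L≡)))
          (cong₂ _+_ (missingAt-part x∈l) (missingAt-part y∈l)))

    double-part-refines : ∀ {a d} → IsMissing l a → largest l ≢ 3 * a → a + a ∈ l →
                          (a + a) + suc d ≡ largest l → ⊥
    double-part-refines {a} {d} ma L≢3a a+a∈l 2a+y≡L with a + suc d ∈? l
    ... | yes a+y∈l = unref (refinable-pair a≢y ma my a+y∈l)
      where
      a≢y : a ≢ suc d
      a≢y refl = L≢3a (begin
        largest l   ≡⟨ 2a+y≡L ⟨
        a + a + a   ≡⟨ +-assoc a a a ⟩
        a + (a + a) ≡⟨ cong (λ t → a + (a + t)) (+-identityʳ a) ⟨
        3 * a       ∎)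
      my : IsMissing l (suc d)
      my = missing-summand (≤-reflexive (trans (+-comm (suc d) (a + a)) 2a+y≡L))
             (not-both-parts 2a+y≡L a+a∈l) (s≤s z≤n)
    ... | no a+y∉l =
      unref (refinable-pair (m+1+n≢m a ∘ sym) ma (missing-summand (≤-reflexive a+y+a≡L) a+y∉l
                                   (≤-trans (s≤s z≤n) (m≤n+m (suc d) a)))
                            (complement-part a (a + suc d) a+[a+y]≡L))
      where
      a+[a+y]≡L : a + (a + suc d) ≡ largest l
      a+[a+y]≡L = trans (sym (+-assoc a a (suc d))) 2a+y≡L
      a+y+a≡L : (a + suc d) + a ≡ largest l
      a+y+a≡L = trans (+-comm (a + suc d) a) a+[a+y]≡L

    double-not-part : ∀ {a} → IsMissing l a → largest l ≢ 3 * a → a + a ∉ l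
    double-not-part {a} ma L≢3a a+a∈l with m≤n⇒∃[o]m+o≡n (double<largest {a} a+a∈l)
    ... | d , 1+2a+d≡L = double-part-refines ma L≢3a a+a∈l (trans (+-suc (a + a) d) 1+2a+d≡L)

    missing-sum-not-part : (∀ μ → IsMissing l μ → largest l ≢ 3 * μ) →
                           ∀ {a b} → IsMissing l a → IsMissing l b → a + b ∉ l
    missing-sum-not-part L≢3μ {a} {b} ma mb with a ≟ b
    ... | yes refl = double-not-part ma (L≢3μ a ma)
    ... | no a≢b   = unref ∘ refinable-pair a≢b ma mb

    closed-under-+ : (∀ μ → IsMissing l μ → largest l ≢ 3 * μ) →
                     ∀ a b → a ∉ l → b ∉ l → a + b ∉ l
    closed-under-+ _ zero _ _ b∉l = b∉l
    closed-under-+ _ a@(suc _) zero a∉l _ = subst (_∉ l) (sym (+-identityʳ a)) a∉l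
    closed-under-+ L≢3μ a@(suc _) b@(suc _) a∉l b∉l a+b∈l =
      missing-sum-not-part L≢3μ
        (missing-summand (≤-largest l a+b∈l) a∉l (s≤s z≤n))
        (missing-summand (subst (_≤ largest l) (+-comm a b) (≤-largest l a+b∈l)) b∉l (s≤s z≤n))
        a+b∈l

mainTheorem5 : (l : List ℕ) → DistinctPartition l → Unrefinable l
    → numMissing l ≡ largest l / 2
    → largest l % 2 ≡ 1
    → (∀ μ → IsMissing l μ → largest l ≢ 3 * μ)
    → NumericalSemigroup (Sλ l)
mainTheorem5 l dp unref count L-odd L≢3μ = record
  { has-zero = 0∉parts dp
  ; closed   = closed-under-+ dp unref (odd-as-double (largest l) L-odd) count L≢3μ
  ; cofinite = suc (largest l) , λ n L<n n∈l → <⇒≱ L<n (≤-largest l n∈l)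
  }
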